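{- Let $G$ be the bipartite graph with vertex set $\{v_1,\dots,v_{10}\}$ (sides $\{v_1,\dots,v_5\}$ and $\{v_6,\dots,v_{10}\}$) and edge set $E=\{\{v_1,v_6\},\{v_1,v_7\},\{v_2,v_6\},\{v_2,v_7\},\{v_2,v_8\},\{v_3,v_7\},\{v_3,v_9\},\{v_3,v_{10}\},\{v_4,v_8\},\{v_4,v_9\},\{v_4,v_{10}\},\{v_5,v_8\},\{v_5,v_9\},\{v_5,v_{10}\}\}$, with red edges $R=\{\{v_2,v_7\},\{v_4,v_9\},\{v_5,v_{10}\}\}$. Let $y\in\mathbb{R}^E$ with $y_{\{v_1,v_6\}}=\frac23$ and $y_e=\frac13$ for all other $e\in E$. Then $y\notin P_{(G,R)}$, i.e., $y$ cannot be written as a convex combination of incidence vectors of perfect matchings $M$ of $G$ with $|M\cap R|$ odd.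
   Context: $P_{(G,R)}:=\operatorname{conv}\{\chi^M\colon M\text{ perfect matching of }G,\ |M\cap R|\text{ odd}\}$.
   Formalization: The coefficients of the convex combinations that the lemma rules out for y are taken in ℚ rather than ℝ. -}

module Defs where

open import Data.Nat using (ℕ; zero; suc; _%_)
open import Data.Integer using (+_)
open import Data.Rational using (ℚ; 0ℚ; 1ℚ; _/_; _+_; _*_; _≤_)
open import Data.Fin using (Fin; zero; suc; #_; _≟_)
open import Data.Bool using (Bool; true; false; if_then_else_; _∧_; _∨_)
open import Data.Product using (_×_; _,_; proj₁; proj₂; Σ; ∃)
open import Data.Vec using (Vec; []; _∷_; lookup)
open import Relation.Nullary.Decidable using (⌊_⌋)
open import Relation.Binary.PropositionalEquality using (_≡_)

-- Vertices v₁ … v₁₀ are Fin 10 with vᵢ ↦ i-1.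
Vertex : Set
Vertex = Fin 10

-- Edges of G, indexed by Fin 14, in the order listed in the paper.
Edge : Set
Edge = Fin 14

edgeList : Vec (Vertex × Vertex) 14
edgeList =
  (# 0 , # 5) ∷ (# 0 , # 6) ∷ (# 1 , # 5) ∷ (# 1 , # 6) ∷ (# 1 , # 7) ∷
  (# 2 , # 6) ∷ (# 2 , # 8) ∷ (# 2 , # 9) ∷ (# 3 , # 7) ∷ (# 3 , # 8) ∷
  (# 3 , # 9) ∷ (# 4 , # 7) ∷ (# 4 , # 8) ∷ (# 4 , # 9) ∷ []

ends : Edge → Vertex × Vertex
ends e = lookup edgeList e

incident : Vertex → Edge → Bool
incident v e = ⌊ v ≟ proj₁ (ends e) ⌋ ∨ ⌊ v ≟ proj₂ (ends e) ⌋

-- red edges R = {v₂v₇, v₄v₉, v₅v₁₀} = edges 3, 9, 13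
red : Edge → Bool
red e = ⌊ e ≟ # 3 ⌋ ∨ ⌊ e ≟ # 9 ⌋ ∨ ⌊ e ≟ # 13 ⌋

count : ∀ {n} → (Fin n → Bool) → ℕ
count {zero} f = 0
count {suc n} f = (if f zero then 1 else 0) Data.Nat.+ count (λ i → f (suc i))

EdgeSet : Set
EdgeSet = Edge → Bool

IsPerfectMatching : EdgeSet → Set
IsPerfectMatching M = ∀ (v : Vertex) → count (λ e → M e ∧ incident v e) ≡ 1

OddRed : EdgeSet → Set
OddRed M = count (λ e → M e ∧ red e) % 2 ≡ 1

χ : EdgeSet → Edge → ℚ
χ M e = if M e then 1ℚ else 0ℚ

Σℚ : ∀ {k} → (Fin k → ℚ) → ℚ
Σℚ {zero} f = 0ℚ
Σℚ {suc k} f = f zero + Σℚ (λ i → f (suc i))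

y : Edge → ℚ
y e = if ⌊ e ≟ # 0 ⌋ then + 2 / 3 else + 1 / 3

InP : (Edge → ℚ) → Set
InP p = Σ ℕ λ k → Σ (Fin k → ℚ) λ λs → Σ (Fin k → EdgeSet) λ Ms →
    (∀ i → 0ℚ ≤ λs i)
  × (∀ i → IsPerfectMatching (Ms i))
  × (∀ i → OddRed (Ms i))
  × (Σℚ λs ≡ 1ℚ)
  × (∀ e → Σℚ (λ i → λs i * χ (Ms i) e) ≡ p e)

-- If the edge v₂v₈ lies in a perfect matching M, then v₂ and v₈ are covered, so v₄ and v₅
-- must be matched into {v₉, v₁₀}: M restricted to the 4-cycle v₄v₉v₅v₁₀ is one of its two
-- perfect matchings, which contain both red edges v₄v₉, v₅v₁₀ or neither, while the third
-- red edge v₂v₇ meets the covered v₂. Hence no odd matching uses v₂v₈, every point of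
-- P_(G,R) vanishes on v₂v₈, and y does not.
module Submission where

open import Defs
open import Relation.Nullary using (¬_)
open import Data.Nat using (zero; suc; _+_; _%_)
open import Data.Bool using (Bool; true; false; _∧_)
open import Data.Bool.Properties using (∧-comm)
open import Data.Fin using (Fin; zero; suc; #_)
open import Data.Vec using ([]; _∷_; lookup)
open import Data.Product using (_,_)
open import Data.Rational using (ℚ; 0ℚ; _*_)
open import Data.Rational.Properties using (*-zeroʳ)
open import Relation.Binary.PropositionalEquality

count-cong : ∀ {n} {f g : Fin n → Bool} → (∀ i → f i ≡ g i) → count f ≡ count g
count-cong {zero}  f≗g = refl
count-cong {suc n} f≗g rewrite f≗g zero = cong (_ +_) (count-cong (λ i → f≗g (suc i)))

count-∧-comm : ∀ {n} (f g : Fin n → Bool) → count (λ i → f i ∧ g i) ≡ count (λ i → g i ∧ f i)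
count-∧-comm f g = count-cong (λ i → ∧-comm (f i) (g i))

Σℚ-zero : ∀ {k} {f : Fin k → ℚ} → (∀ i → f i ≡ 0ℚ) → Σℚ f ≡ 0ℚ
Σℚ-zero {zero}  f≗0 = refl
Σℚ-zero {suc k} f≗0 rewrite f≗0 zero | Σℚ-zero (λ i → f≗0 (suc i)) = refl

data ExactlyOne : Bool → Bool → Bool → Set where
  first  : ExactlyOne true false false
  second : ExactlyOne false true false
  third  : ExactlyOne false false true

exactlyOne : ∀ a b c → count (lookup (a ∷ b ∷ c ∷ [])) ≡ 1 → ExactlyOne a b c
exactlyOne true  false false _ = first
exactlyOne false true  false _ = second
exactlyOne false false true  _ = third
exactlyOne true  true  _     ()
exactlyOne true  false true  ()
exactlyOne false true  true  ()
exactlyOne false false false ()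

-- With the incidence test on the left, both counts normalise to sums over the three
-- edges in question, i.e. to counts of the form count (lookup (a ∷ b ∷ c ∷ [])).
module _ (M : EdgeSet) where

  covers-once : IsPerfectMatching M → ∀ v → count (λ e → incident v e ∧ M e) ≡ 1
  covers-once pm v = trans (count-∧-comm (incident v) M) (pm v)

  odd-on-red : OddRed M → count (λ e → red e ∧ M e) % 2 ≡ 1
  odd-on-red odd = trans (cong (_% 2) (count-∧-comm red M)) odd

-- The arguments are the membership bits of the edges at v₂, v₈, v₄, v₅, v₉, v₁₀
-- and of the red edges, with mᵢ standing for edge i of the list in Defs.
v₂v₈-unusable : ∀ {m₂ m₃ m₄ m₆ m₇ m₈ m₉ m₁₀ m₁₁ m₁₂ m₁₃} →
  ExactlyOne m₂ m₃ m₄ → ExactlyOne m₄ m₈ m₁₁ →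
  ExactlyOne m₈ m₉ m₁₀ → ExactlyOne m₁₁ m₁₂ m₁₃ →
  ExactlyOne m₆ m₉ m₁₂ → ExactlyOne m₇ m₁₀ m₁₃ →
  count (lookup (m₃ ∷ m₉ ∷ m₁₃ ∷ [])) % 2 ≡ 1 →
  m₄ ≡ false
v₂v₈-unusable _     second _      _      _  _  _  = refl
v₂v₈-unusable _     third  _      _      _  _  _  = refl
v₂v₈-unusable third first  second second () _  _
v₂v₈-unusable third first  second third  _  _  ()
v₂v₈-unusable third first  third  second _  _  ()
v₂v₈-unusable third first  third  third  _  () _

oddMatching-avoids-v₂v₈ : ∀ M → IsPerfectMatching M → OddRed M → M (# 4) ≡ false
oddMatching-avoids-v₂v₈ M pm odd =
  v₂v₈-unusable at-v₂ at-v₈ at-v₄ at-v₅ at-v₉ at-v₁₀ (odd-on-red M odd)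
  where
  at-v₂ : ExactlyOne (M (# 2)) (M (# 3)) (M (# 4))
  at-v₂ = exactlyOne _ _ _ (covers-once M pm (# 1))
  at-v₈ : ExactlyOne (M (# 4)) (M (# 8)) (M (# 11))
  at-v₈ = exactlyOne _ _ _ (covers-once M pm (# 7))
  at-v₄ : ExactlyOne (M (# 8)) (M (# 9)) (M (# 10))
  at-v₄ = exactlyOne _ _ _ (covers-once M pm (# 3))
  at-v₅ : ExactlyOne (M (# 11)) (M (# 12)) (M (# 13))
  at-v₅ = exactlyOne _ _ _ (covers-once M pm (# 4))
  at-v₉ : ExactlyOne (M (# 6)) (M (# 9)) (M (# 12))
  at-v₉ = exactlyOne _ _ _ (covers-once M pm (# 8))
  at-v₁₀ : ExactlyOne (M (# 7)) (M (# 10)) (M (# 13))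
  at-v₁₀ = exactlyOne _ _ _ (covers-once M pm (# 9))

InP-vanishes-on-avoided-edge : ∀ {p} e →
  (∀ M → IsPerfectMatching M → OddRed M → M e ≡ false) → InP p → p e ≡ 0ℚ
InP-vanishes-on-avoided-edge e avoided (_ , λs , Ms , _ , pm , odd , _ , p≡) =
  trans (sym (p≡ e)) (Σℚ-zero term≡0)
  where
  term≡0 : ∀ i → λs i * χ (Ms i) e ≡ 0ℚ
  term≡0 i rewrite avoided (Ms i) (pm i) (odd i) = *-zeroʳ (λs i)

lemmaC1 : ¬ InP y
lemmaC1 y∈P with InP-vanishes-on-avoided-edge (# 4) oddMatching-avoids-v₂v₈ y∈P
... | ()
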